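{- Let $\Gamma$ be a relevant collection such that $\Gamma-\{S\}$ is an hke collection for each $S\in\Gamma$. If $|\Gamma|$ is even, then $\Gamma$ is an hke collection.
   Context: A relevant collection is a finite collection $F$ of finite sets all having the same cardinality, a positive integer denoted $\alpha(F)$. A collection $F$ of sets is an hereditary Konig–Egervary (hke) collection if there is a positive integer $\alpha$ such that $|\bigcup\Gamma|+|\bigcap\Gamma|=2\alpha$ for every non-empty subcollection $\Gamma\subseteq F$. -}

module Defs where

open import Data.Nat using (ℕ; zero; suc; _+_; _*_; _<_)
open import Data.Fin using (Fin; punchIn) renaming (zero to fzero; suc to fsuc)
open import Data.Fin.Subset using (Subset; _∪_; _∩_; ⊥; ⊤; ∣_∣; Nonempty)
open import Data.Vec using (_∷_; [])
open import Data.Bool using (Bool; true; false)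
open import Data.Product using (Σ; _×_; ∃)
open import Data.Unit using () renaming (⊤ to Unit)
open import Function using (_∘_)
open import Function.Definitions using (Injective)
open import Relation.Binary.PropositionalEquality using (_≡_)

-- A finite collection of m (distinct) finite sets, all contained in the
-- finite universe Fin n, is represented by an injective family
-- F : Fin m → Subset n.  A subcollection is given by a subset I of the
-- index set Fin m.

⋃over : ∀ {m n} → (Fin m → Subset n) → Subset m → Subset n
⋃over {zero}  F []      = ⊥
⋃over {suc m} F (true  ∷ I) = F fzero ∪ ⋃over (F ∘ fsuc) I
⋃over {suc m} F (false ∷ I) = ⋃over (F ∘ fsuc) I

-- Intersection of the sets F i for i ∈ I (only used for non-empty I).
⋂over : ∀ {m n} → (Fin m → Subset n) → Subset m → Subset n
⋂over {zero}  F []      = ⊤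
⋂over {suc m} F (true  ∷ I) = F fzero ∩ ⋂over (F ∘ fsuc) I
⋂over {suc m} F (false ∷ I) = ⋂over (F ∘ fsuc) I

Relevant : ∀ {m n} → (Fin m → Subset n) → Set
Relevant F = Injective _≡_ _≡_ F × ∃ λ α → 0 < α × (∀ i → ∣ F i ∣ ≡ α)

HKE : ∀ {m n} → (Fin m → Subset n) → Set
HKE {m} F = ∃ λ α → 0 < α ×
  ((I : Subset m) → Nonempty I → ∣ ⋃over F I ∣ + ∣ ⋂over F I ∣ ≡ 2 * α)

-- Γ − {S} is hke for every S ∈ Γ.  (Γ − {F i} is the family F ∘ punchIn i.)
AllRemovalsHKE : ∀ {m n} → (Fin m → Subset n) → Set
AllRemovalsHKE {zero}  F = Unit
AllRemovalsHKE {suc k} F = (i : Fin (suc k)) → HKE (F ∘ punchIn i)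

-- Write f I = ∣⋃ I∣ + ∣⋂ I∣, where ⋂ ∅ is the whole universe, so that f ∅ = n.  Inclusion–exclusion,
-- applied to each element of the universe separately, shows that the alternating sum
-- Σ_I (−1)^∣I∣ f I over all subcollections equals n − f Γ.  Removing a set leaves an hke collection
-- whose constant is the common size α, so f I = 2α whenever ∅ ≠ I ≠ Γ.  For ∣Γ∣ even the signs of
-- these middle terms add up to −2, so the alternating sum is also n + f Γ − 4α, whence f Γ = 2α.
module Submission where

open import Defs
open import Algebra.Properties.CommutativeSemigroup as CSemigroup using ()
open import Data.Bool using (Bool; true; false; _∨_; _∧_)
open import Data.Fin using (Fin; punchIn; punchOut) renaming (zero to fzero; suc to fsuc)
open import Data.Fin.Subset
  using (Subset; inside; outside; _∪_; _∩_; ⊥; ⊤; ∁; ⁅_⁆; ∣_∣; _∈_; _∉_; Nonempty)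
open import Data.Fin.Subset.Properties
  using (nonempty?; Empty-unique; x∈∁p⇒x∉p; p∪∁p≡⊤; ∪-identityʳ; ∩-identityʳ; ∣⊥∣≡0; ∣⊤∣≡n; ∣p∣≤n; x∈⁅x⁆)
open import Data.Nat using (ℕ; zero; suc; _+_; _*_; s≤s; z≤n; parity)
open import Data.Nat.Divisibility using (_∣_; divides)
open import Data.Nat.Properties
  using (+-comm; +-assoc; +-identityʳ; +-cancelˡ-≡; *-cancelˡ-≡; n≤0⇒n≡0; +-commutativeSemigroup)
open import Data.Parity using (Parity; 0ℙ; 1ℙ; _⁻¹)
open import Data.Parity.Properties using (suc-homo-⁻¹; *-homo-*; *-zeroʳ)
open import Data.Product using (∃; _,_)
open import Data.Vec using (_∷_; []; head; tail; tabulate; removeAt; here; there)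
open import Data.Vec.Properties using (removeAt-punchOut; lookup⇒[]=; []=⇒lookup; ≡-dec)
import Data.Bool.Properties as Bool
open import Function using (_∘_; _$_)
open import Relation.Nullary using (yes; no; contradiction)
open import Relation.Binary.PropositionalEquality
  using (_≡_; _≢_; _≗_; refl; sym; trans; cong; cong₂; module ≡-Reasoning)

open CSemigroup +-commutativeSemigroup using (interchange; xy∙z≈xz∙y; x∙yz≈yx∙z)
open ≡-Reasoning

x+x≡y+y⇒x≡y : ∀ {x y} → x + x ≡ y + y → x ≡ y
x+x≡y+y⇒x≡y {x} {y} eq = *-cancelˡ-≡ x y 2 (begin
  x + (x + 0) ≡⟨ cong (x +_) (+-identityʳ x) ⟩
  x + x       ≡⟨ eq ⟩
  y + y       ≡⟨ cong (y +_) (+-identityʳ y) ⟨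
  y + (y + 0) ∎)

[x+y]+[z+w]≡[x+w]+[y+z] : ∀ x y z w → (x + y) + (z + w) ≡ (x + w) + (y + z)
[x+y]+[z+w]≡[x+w]+[y+z] x y z w = trans (cong ((x + y) +_) (+-comm z w)) (interchange x y w z)

2∣1+k⇒parity[k]≡1ℙ : ∀ {k} → 2 ∣ suc k → parity k ≡ 1ℙ
2∣1+k⇒parity[k]≡1ℙ {k} (divides q 1+k≡q*2) = begin
  parity k              ≡⟨ suc-homo-⁻¹ k ⟨
  parity (suc k) ⁻¹     ≡⟨ cong (λ x → parity x ⁻¹) 1+k≡q*2 ⟩
  parity (q * 2) ⁻¹     ≡⟨ cong _⁻¹ (trans (*-homo-* q 2) (*-zeroʳ (parity q))) ⟩
  0ℙ ⁻¹                 ∎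

Σ-parity : ∀ {m} → Parity → (Subset m → ℕ) → ℕ
Σ-parity {zero}  0ℙ h = h []
Σ-parity {zero}  1ℙ h = 0
Σ-parity {suc m} p  h = Σ-parity p (h ∘ (outside ∷_)) + Σ-parity (p ⁻¹) (h ∘ (inside ∷_))

Σ-parity-cong : ∀ {m} p {h h' : Subset m → ℕ} → h ≗ h' → Σ-parity p h ≡ Σ-parity p h'
Σ-parity-cong {zero}  0ℙ h≗h' = h≗h' []
Σ-parity-cong {zero}  1ℙ h≗h' = refl
Σ-parity-cong {suc m} p  h≗h' =
  cong₂ _+_ (Σ-parity-cong p (h≗h' ∘ (outside ∷_))) (Σ-parity-cong (p ⁻¹) (h≗h' ∘ (inside ∷_)))

Σ-parity-+ : ∀ {m} p (h h' : Subset m → ℕ) →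
  Σ-parity p (λ I → h I + h' I) ≡ Σ-parity p h + Σ-parity p h'
Σ-parity-+ {zero}  0ℙ h h' = refl
Σ-parity-+ {zero}  1ℙ h h' = refl
Σ-parity-+ {suc m} p  h h' =
  trans (cong₂ _+_ (Σ-parity-+ p (h ∘ (outside ∷_)) (h' ∘ (outside ∷_)))
                   (Σ-parity-+ (p ⁻¹) (h ∘ (inside ∷_)) (h' ∘ (inside ∷_))))
        (interchange (Σ-parity p (h ∘ (outside ∷_))) (Σ-parity p (h' ∘ (outside ∷_)))
                     (Σ-parity (p ⁻¹) (h ∘ (inside ∷_))) (Σ-parity (p ⁻¹) (h' ∘ (inside ∷_))))

Σ-parity-balanced : ∀ {m} {h : Subset (suc m) → ℕ} →
  (h ∘ (outside ∷_)) ≗ (h ∘ (inside ∷_)) → Σ-parity 0ℙ h ≡ Σ-parity 1ℙ h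
Σ-parity-balanced {h = h} h-indep =
  trans (cong₂ _+_ (Σ-parity-cong 0ℙ h-indep) (sym (Σ-parity-cong 1ℙ h-indep)))
        (+-comm (Σ-parity 0ℙ (h ∘ (inside ∷_))) (Σ-parity 1ℙ (h ∘ (outside ∷_))))

parity-tail : ∀ {m p} (S : Subset m) → parity ∣ inside ∷ S ∣ ≡ p → parity ∣ S ∣ ≡ p ⁻¹
parity-tail S S-parity = trans (sym (suc-homo-⁻¹ ∣ S ∣)) (cong _⁻¹ S-parity)

Σ-parity-update : ∀ {m p} (S : Subset m) {h h' : Subset m → ℕ} → parity ∣ S ∣ ≡ p →
  (∀ I → I ≢ S → h I ≡ h' I) → Σ-parity p h + h' S ≡ Σ-parity p h' + h S
Σ-parity-update []            {h} {h'} refl _ = +-comm (h []) (h' [])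
Σ-parity-update (outside ∷ S) {h} {h'} S-parity agree = begin
  (A + B) + h' (outside ∷ S)  ≡⟨ xy∙z≈xz∙y A B _ ⟩
  (A + h' (outside ∷ S)) + B  ≡⟨ cong₂ _+_ (Σ-parity-update S S-parity agree-tail)
                                           (Σ-parity-cong _ (λ I → agree (inside ∷ I) (λ ()))) ⟩
  (A' + h (outside ∷ S)) + B' ≡⟨ xy∙z≈xz∙y A' B' _ ⟨
  (A' + B') + h (outside ∷ S) ∎
  where
  A  = Σ-parity _ (h ∘ (outside ∷_))
  A' = Σ-parity _ (h' ∘ (outside ∷_))
  B  = Σ-parity _ (h ∘ (inside ∷_))
  B' = Σ-parity _ (h' ∘ (inside ∷_))
  agree-tail : ∀ I → I ≢ S → h (outside ∷ I) ≡ h' (outside ∷ I)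
  agree-tail I I≢S = agree _ (I≢S ∘ cong tail)
Σ-parity-update (inside ∷ S) {h} {h'} S-parity agree = begin
  (A + B) + h' (inside ∷ S)   ≡⟨ +-assoc A B _ ⟩
  A + (B + h' (inside ∷ S))   ≡⟨ cong₂ _+_ (Σ-parity-cong _ (λ I → agree (outside ∷ I) (λ ())))
                                           (Σ-parity-update S (parity-tail S S-parity) agree-tail) ⟩
  A' + (B' + h (inside ∷ S))  ≡⟨ +-assoc A' B' _ ⟨
  (A' + B') + h (inside ∷ S)  ∎
  where
  A  = Σ-parity _ (h ∘ (outside ∷_))
  A' = Σ-parity _ (h' ∘ (outside ∷_))
  B  = Σ-parity _ (h ∘ (inside ∷_))
  B' = Σ-parity _ (h' ∘ (inside ∷_))
  agree-tail : ∀ I → I ≢ S → h (inside ∷ I) ≡ h' (inside ∷ I)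
  agree-tail I I≢S = agree _ (I≢S ∘ cong tail)

Σ-parity-update-other : ∀ {m p} (S : Subset m) {h h' : Subset m → ℕ} → parity ∣ S ∣ ≡ p →
  (∀ I → I ≢ S → h I ≡ h' I) → Σ-parity (p ⁻¹) h ≡ Σ-parity (p ⁻¹) h'
Σ-parity-update-other []            refl _ = refl
Σ-parity-update-other (outside ∷ S) S-parity agree =
  cong₂ _+_ (Σ-parity-update-other S S-parity (λ I I≢S → agree _ (I≢S ∘ cong tail)))
            (Σ-parity-cong _ (λ I → agree (inside ∷ I) (λ ())))
Σ-parity-update-other (inside ∷ S) S-parity agree =
  cong₂ _+_ (Σ-parity-cong _ (λ I → agree (outside ∷ I) (λ ())))
            (Σ-parity-update-other S (parity-tail S S-parity) (λ I I≢S → agree _ (I≢S ∘ cong tail)))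

-- `AltSum h a b` says that the alternating sum of h, Σ_I (−1)^∣I∣ h I, equals a − b.
record AltSum {m} (h : Subset m → ℕ) (a b : ℕ) : Set where
  constructor altSum
  field balance : Σ-parity 0ℙ h + b ≡ Σ-parity 1ℙ h + a

AltSum-cong : ∀ {m} {h h' : Subset m → ℕ} {a a' b b'} →
  h ≗ h' → a ≡ a' → b ≡ b' → AltSum h a b → AltSum h' a' b'
AltSum-cong {b = b} h≗h' refl refl (altSum alt) = altSum $
  trans (cong (_+ b) (sym (Σ-parity-cong 0ℙ h≗h'))) (trans alt (cong (_+ _) (Σ-parity-cong 1ℙ h≗h')))

AltSum-+ : ∀ {m} {h h' : Subset m → ℕ} {a a' b b'} →
  AltSum h a b → AltSum h' a' b' → AltSum (λ I → h I + h' I) (a + a') (b + b')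
AltSum-+ {h = h} {h'} {a} {a'} {b} {b'} (altSum alt) (altSum alt') = altSum $ begin
  Σ-parity 0ℙ (λ I → h I + h' I) + (b + b')  ≡⟨ cong (_+ (b + b')) (Σ-parity-+ 0ℙ h h') ⟩
  (E + E') + (b + b')                          ≡⟨ interchange E E' b b' ⟩
  (E + b) + (E' + b')                          ≡⟨ cong₂ _+_ alt alt' ⟩
  (O + a) + (O' + a')                          ≡⟨ interchange O a O' a' ⟩
  (O + O') + (a + a')                          ≡⟨ cong (_+ (a + a')) (Σ-parity-+ 1ℙ h h') ⟨
  Σ-parity 1ℙ (λ I → h I + h' I) + (a + a')  ∎
  where
  E  = Σ-parity 0ℙ h
  E' = Σ-parity 0ℙ h'
  O  = Σ-parity 1ℙ h
  O' = Σ-parity 1ℙ h'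

-- The subsets containing the first index enter with the opposite sign, hence the swapped a', b'.
AltSum-∷ : ∀ {m} {h : Subset (suc m) → ℕ} {a a' b b'} →
  AltSum (h ∘ (outside ∷_)) a b → AltSum (h ∘ (inside ∷_)) b' a' → AltSum h (a' + a) (b' + b)
AltSum-∷ {h = h} {a} {a'} {b} {b'} (altSum alt-out) (altSum alt-in) = altSum $ begin
  (E-out + O-in) + (b' + b)   ≡⟨ [x+y]+[z+w]≡[x+w]+[y+z] E-out O-in b' b ⟩
  (E-out + b) + (O-in + b')   ≡⟨ cong₂ _+_ alt-out (sym alt-in) ⟩
  (O-out + a) + (E-in + a')   ≡⟨ [x+y]+[z+w]≡[x+w]+[y+z] O-out E-in a' a ⟨
  (O-out + E-in) + (a' + a)   ∎
  where
  E-out = Σ-parity 0ℙ (h ∘ (outside ∷_))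
  O-out = Σ-parity 1ℙ (h ∘ (outside ∷_))
  E-in  = Σ-parity 0ℙ (h ∘ (inside ∷_))
  O-in  = Σ-parity 1ℙ (h ∘ (inside ∷_))

AltSum-independent : ∀ {m} {h : Subset (suc m) → ℕ} {a} →
  (h ∘ (outside ∷_)) ≗ (h ∘ (inside ∷_)) → AltSum h a a
AltSum-independent {h = h} {a} h-indep = altSum $ cong (_+ a) (Σ-parity-balanced {h = h} h-indep)

AltSum-unique : ∀ {m} {h : Subset m → ℕ} {a a' b b'} →
  AltSum h a b → AltSum h a' b' → a + b' ≡ a' + b
AltSum-unique {h = h} {a} {a'} {b} {b'} (altSum alt) (altSum alt') =
  +-cancelˡ-≡ (E + O) (a + b') (a' + b) $ begin
  (E + O) + (a + b')   ≡⟨ [x+y]+[z+w]≡[x+w]+[y+z] E O a b' ⟩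
  (E + b') + (O + a)   ≡⟨ cong₂ _+_ alt' (sym alt) ⟩
  (O + a') + (E + b)   ≡⟨ +-comm (O + a') (E + b) ⟩
  (E + b) + (O + a')   ≡⟨ [x+y]+[z+w]≡[x+w]+[y+z] E O a' b ⟨
  (E + O) + (a' + b)   ∎
  where
  E = Σ-parity 0ℙ h
  O = Σ-parity 1ℙ h

AltSum-two-point : ∀ {k} (h : Subset (suc k) → ℕ) {c} → parity k ≡ 1ℙ →
  (∀ I → I ≢ ⊥ → I ≢ ⊤ → h I ≡ c) → AltSum h (h ⊤ + h ⊥) (c + c)
AltSum-two-point {zero}  h ()
AltSum-two-point {suc k} h {c} k-odd h≡c = AltSum-∷ at-⊥ at-⊤
  where
  const : Subset (suc k) → ℕ
  const _ = c
  balanced : Σ-parity 0ℙ const ≡ Σ-parity 1ℙ const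
  balanced = Σ-parity-balanced {h = const} (λ _ → refl)
  ⊥-even : parity ∣ ⊥ {suc k} ∣ ≡ 0ℙ
  ⊥-even = cong parity (∣⊥∣≡0 (suc k))
  ⊤-odd : parity ∣ ⊤ {suc k} ∣ ≡ 1ℙ
  ⊤-odd = trans (cong parity (∣⊤∣≡n (suc k))) k-odd
  off-⊥ : ∀ I → I ≢ ⊥ → h (outside ∷ I) ≡ c
  off-⊥ I I≢⊥ = h≡c _ (I≢⊥ ∘ cong tail) (λ ())
  off-⊤ : ∀ I → I ≢ ⊤ → h (inside ∷ I) ≡ c
  off-⊤ I I≢⊤ = h≡c _ (λ ()) (I≢⊤ ∘ cong tail)
  at-⊥ : AltSum (h ∘ (outside ∷_)) (h ⊥) c
  at-⊥ = altSum $ begin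
    Σ-parity 0ℙ (h ∘ (outside ∷_)) + c    ≡⟨ Σ-parity-update ⊥ ⊥-even off-⊥ ⟩
    Σ-parity 0ℙ const + h ⊥               ≡⟨ cong (_+ h ⊥) balanced ⟩
    Σ-parity 1ℙ const + h ⊥               ≡⟨ cong (_+ h ⊥) (Σ-parity-update-other ⊥ ⊥-even off-⊥) ⟨
    Σ-parity 1ℙ (h ∘ (outside ∷_)) + h ⊥  ∎
  at-⊤ : AltSum (h ∘ (inside ∷_)) c (h ⊤)
  at-⊤ = altSum $ begin
    Σ-parity 0ℙ (h ∘ (inside ∷_)) + h ⊤   ≡⟨ cong (_+ h ⊤) (Σ-parity-update-other ⊤ ⊤-odd off-⊤) ⟩
    Σ-parity 0ℙ const + h ⊤               ≡⟨ cong (_+ h ⊤) balanced ⟩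
    Σ-parity 1ℙ const + h ⊤               ≡⟨ Σ-parity-update ⊤ ⊤-odd off-⊤ ⟨
    Σ-parity 1ℙ (h ∘ (inside ∷_)) + c     ∎

toℕ : Bool → ℕ
toℕ false = 0
toℕ true  = 1

∣x∷p∣≡toℕ[x]+∣p∣ : ∀ {n} b (S : Subset n) → ∣ b ∷ S ∣ ≡ toℕ b + ∣ S ∣
∣x∷p∣≡toℕ[x]+∣p∣ inside  S = refl
∣x∷p∣≡toℕ[x]+∣p∣ outside S = refl

_meetsᵇ_ : ∀ {m} → Subset m → Subset m → Bool
[]            meetsᵇ []      = false
(inside  ∷ I) meetsᵇ (b ∷ c) = b ∨ (I meetsᵇ c)
(outside ∷ I) meetsᵇ (_ ∷ c) = I meetsᵇ c

_⊆ᵇ_ : ∀ {m} → Subset m → Subset m → Bool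
[]            ⊆ᵇ []      = true
(inside  ∷ I) ⊆ᵇ (b ∷ c) = b ∧ (I ⊆ᵇ c)
(outside ∷ I) ⊆ᵇ (_ ∷ c) = I ⊆ᵇ c

meetsᵇ-alternating : ∀ {k} (c : Subset (suc k)) →
  AltSum (λ I → toℕ (I meetsᵇ c)) 0 (toℕ (⊤ ⊆ᵇ c))
meetsᵇ-alternating {zero}  (inside  ∷ []) = altSum refl
meetsᵇ-alternating {zero}  (outside ∷ []) = altSum refl
meetsᵇ-alternating {suc k} (inside  ∷ c)  =
  AltSum-∷ (meetsᵇ-alternating c) (AltSum-independent (λ _ → refl))
meetsᵇ-alternating {suc k} (outside ∷ c)  = AltSum-independent (λ _ → refl)

⊆ᵇ-alternating : ∀ {k} (c : Subset (suc k)) →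
  AltSum (λ I → toℕ (I ⊆ᵇ c)) 1 (toℕ (⊤ meetsᵇ c))
⊆ᵇ-alternating {zero}  (inside  ∷ []) = altSum refl
⊆ᵇ-alternating {zero}  (outside ∷ []) = altSum refl
⊆ᵇ-alternating {suc k} (inside  ∷ c)  = AltSum-independent (λ _ → refl)
⊆ᵇ-alternating {suc k} (outside ∷ c)  =
  AltSum-∷ (⊆ᵇ-alternating c) (AltSum-independent (λ _ → refl))

-- The summand of ∣⋃ I∣ + ∣⋂ I∣ due to one element of the universe, lying in the sets indexed by c.
contribution : ∀ {m} → Subset m → Subset m → ℕ
contribution c I = toℕ (I meetsᵇ c) + toℕ (I ⊆ᵇ c)

contribution-alternating : ∀ {k} (c : Subset (suc k)) → AltSum (contribution c) 1 (contribution c ⊤)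
contribution-alternating c =
  AltSum-cong (λ _ → refl) refl (+-comm (toℕ (⊤ ⊆ᵇ c)) _)
    (AltSum-+ (meetsᵇ-alternating c) (⊆ᵇ-alternating c))

∣⋃∣+∣⋂∣ : ∀ {m n} → (Fin m → Subset n) → Subset m → ℕ
∣⋃∣+∣⋂∣ F I = ∣ ⋃over F I ∣ + ∣ ⋂over F I ∣

⋃over-∷ : ∀ {m n} (F : Fin m → Subset (suc n)) I →
  ⋃over F I ≡ (I meetsᵇ tabulate (head ∘ F)) ∷ ⋃over (tail ∘ F) I
⋃over-∷ {zero}  F []            = refl
⋃over-∷ {suc m} F (inside  ∷ I) = trans (cong (F fzero ∪_) (⋃over-∷ (F ∘ fsuc) I)) (∪-∷ (F fzero))
  where
  ∪-∷ : ∀ {n b} {S : Subset n} (T : Subset (suc n)) → T ∪ (b ∷ S) ≡ (head T ∨ b) ∷ (tail T ∪ S)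
  ∪-∷ (_ ∷ _) = refl
⋃over-∷ {suc m} F (outside ∷ I) = ⋃over-∷ (F ∘ fsuc) I

⋂over-∷ : ∀ {m n} (F : Fin m → Subset (suc n)) I →
  ⋂over F I ≡ (I ⊆ᵇ tabulate (head ∘ F)) ∷ ⋂over (tail ∘ F) I
⋂over-∷ {zero}  F []            = refl
⋂over-∷ {suc m} F (inside  ∷ I) = trans (cong (F fzero ∩_) (⋂over-∷ (F ∘ fsuc) I)) (∩-∷ (F fzero))
  where
  ∩-∷ : ∀ {n b} {S : Subset n} (T : Subset (suc n)) → T ∩ (b ∷ S) ≡ (head T ∧ b) ∷ (tail T ∩ S)
  ∩-∷ (_ ∷ _) = refl
⋂over-∷ {suc m} F (outside ∷ I) = ⋂over-∷ (F ∘ fsuc) I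

∣⋃∣+∣⋂∣-∷ : ∀ {m n} (F : Fin m → Subset (suc n)) I →
  ∣⋃∣+∣⋂∣ F I ≡ contribution (tabulate (head ∘ F)) I + ∣⋃∣+∣⋂∣ (tail ∘ F) I
∣⋃∣+∣⋂∣-∷ F I = begin
  ∣ ⋃over F I ∣ + ∣ ⋂over F I ∣
    ≡⟨ cong₂ _+_ (cong ∣_∣ (⋃over-∷ F I)) (cong ∣_∣ (⋂over-∷ F I)) ⟩
  ∣ meets ∷ ⋃over F' I ∣ + ∣ within ∷ ⋂over F' I ∣
    ≡⟨ cong₂ _+_ (∣x∷p∣≡toℕ[x]+∣p∣ meets (⋃over F' I)) (∣x∷p∣≡toℕ[x]+∣p∣ within (⋂over F' I)) ⟩
  (toℕ meets + ∣ ⋃over F' I ∣) + (toℕ within + ∣ ⋂over F' I ∣)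
    ≡⟨ interchange (toℕ meets) _ (toℕ within) _ ⟩
  contribution c I + ∣⋃∣+∣⋂∣ F' I
    ∎
  where
  c = tabulate (head ∘ F)
  F' = tail ∘ F
  meets = I meetsᵇ c
  within = I ⊆ᵇ c

∣⋃∣+∣⋂∣-alternating : ∀ {k n} (F : Fin (suc k) → Subset n) → AltSum (∣⋃∣+∣⋂∣ F) n (∣⋃∣+∣⋂∣ F ⊤)
∣⋃∣+∣⋂∣-alternating {n = zero} F =
  AltSum-cong (sym ∘ vanishes) refl (sym (vanishes ⊤)) (AltSum-independent (λ _ → refl))
  where
  vanishes : ∀ I → ∣⋃∣+∣⋂∣ F I ≡ 0
  vanishes I = cong₂ _+_ (n≤0⇒n≡0 (∣p∣≤n (⋃over F I))) (n≤0⇒n≡0 (∣p∣≤n (⋂over F I)))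
∣⋃∣+∣⋂∣-alternating {n = suc n} F =
  AltSum-cong (sym ∘ ∣⋃∣+∣⋂∣-∷ F) refl (sym (∣⋃∣+∣⋂∣-∷ F ⊤))
    (AltSum-+ (contribution-alternating (tabulate (head ∘ F))) (∣⋃∣+∣⋂∣-alternating (tail ∘ F)))

⋃over-⊥ : ∀ {m n} (F : Fin m → Subset n) → ⋃over F ⊥ ≡ ⊥
⋃over-⊥ {zero}  F = refl
⋃over-⊥ {suc m} F = ⋃over-⊥ (F ∘ fsuc)

⋂over-⊥ : ∀ {m n} (F : Fin m → Subset n) → ⋂over F ⊥ ≡ ⊤
⋂over-⊥ {zero}  F = refl
⋂over-⊥ {suc m} F = ⋂over-⊥ (F ∘ fsuc)

∣⋃∣+∣⋂∣-⊥ : ∀ {m n} (F : Fin m → Subset n) → ∣⋃∣+∣⋂∣ F ⊥ ≡ n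
∣⋃∣+∣⋂∣-⊥ {n = n} F =
  cong₂ _+_ (trans (cong ∣_∣ (⋃over-⊥ F)) (∣⊥∣≡0 n)) (trans (cong ∣_∣ (⋂over-⊥ F)) (∣⊤∣≡n n))

⋃over-⁅⁆ : ∀ {m n} (F : Fin m → Subset n) j → ⋃over F ⁅ j ⁆ ≡ F j
⋃over-⁅⁆ F fzero    = trans (cong (F fzero ∪_) (⋃over-⊥ (F ∘ fsuc))) (∪-identityʳ (F fzero))
⋃over-⁅⁆ F (fsuc j) = ⋃over-⁅⁆ (F ∘ fsuc) j

⋂over-⁅⁆ : ∀ {m n} (F : Fin m → Subset n) j → ⋂over F ⁅ j ⁆ ≡ F j
⋂over-⁅⁆ F fzero    = trans (cong (F fzero ∩_) (⋂over-⊥ (F ∘ fsuc))) (∩-identityʳ (F fzero))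
⋂over-⁅⁆ F (fsuc j) = ⋂over-⁅⁆ (F ∘ fsuc) j

∣⋃∣+∣⋂∣-⁅⁆ : ∀ {m n} (F : Fin m → Subset n) j → ∣⋃∣+∣⋂∣ F ⁅ j ⁆ ≡ 2 * ∣ F j ∣
∣⋃∣+∣⋂∣-⁅⁆ F j = begin
  ∣ ⋃over F ⁅ j ⁆ ∣ + ∣ ⋂over F ⁅ j ⁆ ∣ ≡⟨ cong₂ _+_ (cong ∣_∣ (⋃over-⁅⁆ F j)) (cong ∣_∣ (⋂over-⁅⁆ F j)) ⟩
  ∣ F j ∣ + ∣ F j ∣                     ≡⟨ cong (∣ F j ∣ +_) (+-identityʳ ∣ F j ∣) ⟨
  2 * ∣ F j ∣                           ∎

⋃over-removeAt : ∀ {k n} (F : Fin (suc k) → Subset n) {I i} → i ∉ I →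
  ⋃over F I ≡ ⋃over (F ∘ punchIn i) (removeAt I i)
⋃over-removeAt F {inside  ∷ I} {fzero} i∉I = contradiction here i∉I
⋃over-removeAt F {outside ∷ I} {fzero} _   = refl
⋃over-removeAt F {inside  ∷ I@(_ ∷ _)} {fsuc i} i∉I =
  cong (F fzero ∪_) (⋃over-removeAt (F ∘ fsuc) (i∉I ∘ there))
⋃over-removeAt F {outside ∷ I@(_ ∷ _)} {fsuc i} i∉I = ⋃over-removeAt (F ∘ fsuc) (i∉I ∘ there)

⋂over-removeAt : ∀ {k n} (F : Fin (suc k) → Subset n) {I i} → i ∉ I →
  ⋂over F I ≡ ⋂over (F ∘ punchIn i) (removeAt I i)
⋂over-removeAt F {inside  ∷ I} {fzero} i∉I = contradiction here i∉I
⋂over-removeAt F {outside ∷ I} {fzero} _   = refl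
⋂over-removeAt F {inside  ∷ I@(_ ∷ _)} {fsuc i} i∉I =
  cong (F fzero ∩_) (⋂over-removeAt (F ∘ fsuc) (i∉I ∘ there))
⋂over-removeAt F {outside ∷ I@(_ ∷ _)} {fsuc i} i∉I = ⋂over-removeAt (F ∘ fsuc) (i∉I ∘ there)

∣⋃∣+∣⋂∣-removeAt : ∀ {k n} (F : Fin (suc k) → Subset n) {I i} → i ∉ I →
  ∣⋃∣+∣⋂∣ F I ≡ ∣⋃∣+∣⋂∣ (F ∘ punchIn i) (removeAt I i)
∣⋃∣+∣⋂∣-removeAt F i∉I =
  cong₂ _+_ (cong ∣_∣ (⋃over-removeAt F i∉I)) (cong ∣_∣ (⋂over-removeAt F i∉I))

removeAt-nonempty : ∀ {k} {I : Subset (suc k)} {i j} → i ∉ I → j ∈ I → Nonempty (removeAt I i)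
removeAt-nonempty {I = I} {i} {j} i∉I j∈I =
  punchOut i≢j , lookup⇒[]= _ _ (trans (removeAt-punchOut I i≢j) ([]=⇒lookup j∈I))
  where
  i≢j : i ≢ j
  i≢j refl = i∉I j∈I

≢⊤⇒∃∉ : ∀ {m} {I : Subset m} → I ≢ ⊤ → ∃ λ i → i ∉ I
≢⊤⇒∃∉ {I = I} I≢⊤ with nonempty? (∁ I)
... | yes (i , i∈∁I) = i , x∈∁p⇒x∉p i∈∁I
... | no ∁I-empty    = contradiction I≡⊤ I≢⊤
  where
  I≡⊤ : I ≡ ⊤
  I≡⊤ = begin
    I       ≡⟨ ∪-identityʳ I ⟨
    I ∪ ⊥   ≡⟨ cong (I ∪_) (Empty-unique ∁I-empty) ⟨
    I ∪ ∁ I ≡⟨ p∪∁p≡⊤ I ⟩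
    ⊤       ∎

≢⊥⇒Nonempty : ∀ {m} {I : Subset m} → I ≢ ⊥ → Nonempty I
≢⊥⇒Nonempty {I = I} I≢⊥ with nonempty? I
... | yes I-nonempty = I-nonempty
... | no  I-empty    = contradiction (Empty-unique I-empty) I≢⊥

hke-constant : ∀ {k n} (G : Fin (suc k) → Subset n) {α} →
  (∀ I → Nonempty I → ∣⋃∣+∣⋂∣ G I ≡ 2 * α) → ∀ j → α ≡ ∣ G j ∣
hke-constant G {α} hke j =
  *-cancelˡ-≡ α ∣ G j ∣ 2 (trans (sym (hke ⁅ j ⁆ (j , x∈⁅x⁆ j))) (∣⋃∣+∣⋂∣-⁅⁆ G j))

∣⋃∣+∣⋂∣-proper : ∀ {k n} (F : Fin (suc (suc k)) → Subset n) {α} → (∀ i → ∣ F i ∣ ≡ α) →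
  AllRemovalsHKE F → ∀ I → Nonempty I → I ≢ ⊤ → ∣⋃∣+∣⋂∣ F I ≡ 2 * α
∣⋃∣+∣⋂∣-proper F {α} ∣Fi∣≡α removals-hke I (j , j∈I) I≢⊤ with ≢⊤⇒∃∉ I≢⊤
... | i , i∉I with removals-hke i
...   | α' , _ , hke = begin
  ∣⋃∣+∣⋂∣ F I                            ≡⟨ ∣⋃∣+∣⋂∣-removeAt F i∉I ⟩
  ∣⋃∣+∣⋂∣ (F ∘ punchIn i) (removeAt I i) ≡⟨ hke (removeAt I i) (removeAt-nonempty {I = I} i∉I j∈I) ⟩
  2 * α'                                 ≡⟨ cong (2 *_) (hke-constant (F ∘ punchIn i) {α'} hke fzero) ⟩
  2 * ∣ F (punchIn i fzero) ∣            ≡⟨ cong (2 *_) (∣Fi∣≡α (punchIn i fzero)) ⟩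
  2 * α                                  ∎

∣⋃∣+∣⋂∣-⊤ : ∀ {k n} (F : Fin (suc k) → Subset n) {c} → parity k ≡ 1ℙ →
  (∀ I → Nonempty I → I ≢ ⊤ → ∣⋃∣+∣⋂∣ F I ≡ c) → ∣⋃∣+∣⋂∣ F ⊤ ≡ c
∣⋃∣+∣⋂∣-⊤ {n = n} F {c} k-odd proper = x+x≡y+y⇒x≡y (+-cancelˡ-≡ n (t + t) (c + c) (begin
  n + (t + t)          ≡⟨ x∙yz≈yx∙z n t t ⟩
  (t + n) + t          ≡⟨ cong (λ x → (t + x) + t) (∣⋃∣+∣⋂∣-⊥ F) ⟨
  (t + f ⊥) + t        ≡⟨ AltSum-unique (∣⋃∣+∣⋂∣-alternating F) two-point ⟨
  n + (c + c)          ∎))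
  where
  f = ∣⋃∣+∣⋂∣ F
  t = f ⊤
  two-point : AltSum f (t + f ⊥) (c + c)
  two-point = AltSum-two-point f k-odd (λ I I≢⊥ → proper I (≢⊥⇒Nonempty I≢⊥))

corollary2p7 : (m n : ℕ) (F : Fin m → Subset n) → Relevant F →
    AllRemovalsHKE F → 2 ∣ m → HKE F
corollary2p7 zero          n F _ _ _   = 1 , s≤s z≤n , λ { _ (() , _) }
corollary2p7 (suc zero)    n F _ _ 2∣1 = contradiction (2∣1+k⇒parity[k]≡1ℙ 2∣1) λ ()
corollary2p7 (suc (suc k)) n F (_ , α , α>0 , ∣Fi∣≡α) removals-hke 2∣m = α , α>0 , value
  where
  proper : ∀ I → Nonempty I → I ≢ ⊤ → ∣⋃∣+∣⋂∣ F I ≡ 2 * α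
  proper = ∣⋃∣+∣⋂∣-proper F ∣Fi∣≡α removals-hke
  value : ∀ I → Nonempty I → ∣⋃∣+∣⋂∣ F I ≡ 2 * α
  value I I-nonempty with ≡-dec Bool._≟_ I ⊤
  ... | yes refl = ∣⋃∣+∣⋂∣-⊤ F (2∣1+k⇒parity[k]≡1ℙ 2∣m) proper
  ... | no  I≢⊤  = proper I I-nonempty I≢⊤
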